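{- Let $t,u$ be CBN terms and $s'$ a Bang term. 1. (Stability) If $t^{n}\to_F^* s'$, then there is a CBN term $s$ with $s^{n}=s'$. 2. (Normal forms) $t$ is a normal form for CBN full reduction if and only if $t^{n}$ is a normal form for Bang full reduction $\to_F$. 3. (Simulations) $t \to_F^* u$ in CBN if and only if $t^{n}\to_F^* u^{n}$ in the Distant Bang Calculus. Moreover, the number of $dB$/$s$-steps on the left matches the number of $dB$/$s!$-steps on the right.
   Context: Distant Bang Calculus. Terms: $t,u,s ::= x \mid t\,u \mid \lambda x.t \mid !t \mid \mathrm{der}(t) \mid t[x\backslash u]$; $\lambda x.t$ and $t[x\backslash u]$ bind $x$ in $t$; terms up to $\alpha$-conversion; $t\{x:=u\}$ is capture-avoiding substitution. Contexts have exactly one hole $\square$, $C\langle t\rangle$ is plugging. Full contexts: $F ::= \square \mid F\,t \mid t\,F \mid \lambda x.F \mid !F \mid \mathrm{der}(F) \mid F[x\backslash t] \mid t[x\backslash F]$; list contexts $L ::= \square \mid L[x\backslash t]$. Rules (capture-free w.r.t. $L$): $(dB)$ $L\langle \lambda x.t\rangle\,u \mapsto L\langle t[x\backslash u]\rangle$; $(s!)$ $t[x\backslash L\langle !u\rangle] \mapsto L\langle t\{x:=u\}\rangle$; $(d!)$ $\mathrm{der}(L\langle !t\rangle) \mapsto L\langle t\rangle$. Full reduction $\to_F$: $F\langle t\rangle\to_F F\langle u\rangle$ for any full context $F$ and $t\mapsto_R u$ with $R\in\{dB,s!,d!\}$. CBN calculus. Terms $t,u ::= x \mid \lambda x.t \mid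 t\,u \mid t[x\backslash u]$; full contexts $G ::= \square \mid G\,t \mid t\,G \mid \lambda x.G \mid G[x\backslash t] \mid t[x\backslash G]$; list contexts $L ::= \square \mid L[x\backslash t]$. Rules: $(dB)$ $L\langle \lambda x.t\rangle\,u \mapsto L\langle t[x\backslash u]\rangle$ (capture-free), $(s)$ $t[x\backslash u]\mapsto t\{x:=u\}$. CBN full reduction $\to_F$: closure of $dB$ and $s$ under all CBN full contexts. CBN embedding $(\cdot)^n$: $x^n=x$, $(\lambda x.t)^n=\lambda x.t^n$, $(t\,u)^n=t^n\,!u^n$, $(t[x\backslash u])^n=t^n[x\backslash !u^n]$. $\to^*$ is reflexive-transitive closure. -}

module Defs where

-- Terms up to alpha-conversion are represented with well-scoped de Bruijn
-- indices: a term of type  Tm n  has free variables among  Fin n .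

open import Data.Nat using (ℕ; zero; suc)
open import Data.Fin using (Fin; zero; suc)
open import Data.Product using (Σ; _,_)
open import Relation.Nullary using (¬_)
open import Relation.Binary.Construct.Closure.ReflexiveTransitive using (Star)

Ren : ℕ → ℕ → Set
Ren n m = Fin n → Fin m

extR : ∀ {n m} → Ren n m → Ren (suc n) (suc m)
extR ρ zero    = zero
extR ρ (suc i) = suc (ρ i)

module Bang where

  data Tm (n : ℕ) : Set where
    var  : Fin n → Tm n
    app  : Tm n → Tm n → Tm n
    lam  : Tm (suc n) → Tm n
    bang : Tm n → Tm n
    der  : Tm n → Tm n
    es   : Tm (suc n) → Tm n → Tm n     -- t[x\u]  (x bound in t)

  ren : ∀ {n m} → Ren n m → Tm n → Tm m
  ren ρ (var i)   = var (ρ i)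
  ren ρ (app t u) = app (ren ρ t) (ren ρ u)
  ren ρ (lam t)   = lam (ren (extR ρ) t)
  ren ρ (bang t)  = bang (ren ρ t)
  ren ρ (der t)   = der (ren ρ t)
  ren ρ (es t u)  = es (ren (extR ρ) t) (ren ρ u)

  Sub : ℕ → ℕ → Set
  Sub n m = Fin n → Tm m

  extS : ∀ {n m} → Sub n m → Sub (suc n) (suc m)
  extS σ zero    = var zero
  extS σ (suc i) = ren suc (σ i)

  sub : ∀ {n m} → Sub n m → Tm n → Tm m
  sub σ (var i)   = σ i
  sub σ (app t u) = app (sub σ t) (sub σ u)
  sub σ (lam t)   = lam (sub (extS σ) t)
  sub σ (bang t)  = bang (sub σ t)
  sub σ (der t)   = der (sub σ t)
  sub σ (es t u)  = es (sub (extS σ) t) (sub σ u)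

  -- t{x:=u} where x is the variable 0 of t
  sub0 : ∀ {n} → Tm (suc n) → Tm n → Tm n
  sub0 {n} t u = sub σ t
    where
    σ : Sub (suc n) n
    σ zero    = u
    σ (suc i) = var i

  -- list contexts L ::= □ | L[x\t]; LCtx n m : outer scope n, hole scope m
  data LCtx (n : ℕ) : ℕ → Set where
    hole : LCtx n n
    lsub : ∀ {m} → LCtx (suc n) m → Tm n → LCtx n m

  plug : ∀ {n m} → LCtx n m → Tm m → Tm n
  plug hole       t = t
  plug (lsub L s) t = es (plug L t) s

  -- weakening past the binders of L (makes the rules capture-free)
  wkL : ∀ {n m} → LCtx n m → Ren n m
  wkL hole       i = i
  wkL (lsub L s) i = wkL L (suc i)

  data Rule : Set where
    dB s! d! : Rule

  data _↦[_]_ {n : ℕ} : Tm n → Rule → Tm n → Set where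
    ↦dB : ∀ {m} (L : LCtx n m) (t : Tm (suc m)) (u : Tm n) →
          app (plug L (lam t)) u ↦[ dB ] plug L (es t (ren (wkL L) u))
    ↦s! : ∀ {m} (t : Tm (suc n)) (L : LCtx n m) (u : Tm m) →
          es t (plug L (bang u)) ↦[ s! ] plug L (sub0 (ren (extR (wkL L)) t) u)
    ↦d! : ∀ {m} (L : LCtx n m) (t : Tm m) →
          der (plug L (bang t)) ↦[ d! ] plug L t

  data _→F[_]_ : ∀ {n} → Tm n → Rule → Tm n → Set where
    root  : ∀ {n R} {t u : Tm n} → t ↦[ R ] u → t →F[ R ] u
    appL  : ∀ {n R} {t t' : Tm n} (u : Tm n) → t →F[ R ] t' → app t u →F[ R ] app t' u
    appR  : ∀ {n R} (t : Tm n) {u u' : Tm n} → u →F[ R ] u' → app t u →F[ R ] app t u'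
    lamC  : ∀ {n R} {t t' : Tm (suc n)} → t →F[ R ] t' → lam t →F[ R ] lam t'
    bangC : ∀ {n R} {t t' : Tm n} → t →F[ R ] t' → bang t →F[ R ] bang t'
    derC  : ∀ {n R} {t t' : Tm n} → t →F[ R ] t' → der t →F[ R ] der t'
    esL   : ∀ {n R} {t t' : Tm (suc n)} (u : Tm n) → t →F[ R ] t' → es t u →F[ R ] es t' u
    esR   : ∀ {n R} (t : Tm (suc n)) {u u' : Tm n} → u →F[ R ] u' → es t u →F[ R ] es t u'

  _→F_ : ∀ {n} → Tm n → Tm n → Set
  t →F u = Σ Rule λ R → t →F[ R ] u

  _→F*_ : ∀ {n} → Tm n → Tm n → Set
  _→F*_ = Star _→F_

  Normal : ∀ {n} → Tm n → Set
  Normal t = ¬ (Σ _ λ u → t →F u)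

  -- t →F* u using exactly k dB-steps and m s!-steps (d!-steps not counted)
  data Steps {n : ℕ} : ℕ → ℕ → Tm n → Tm n → Set where
    done  : ∀ {t} → Steps 0 0 t t
    stdB  : ∀ {k m t t' u} → t →F[ dB ] t' → Steps k m t' u → Steps (suc k) m t u
    sts!  : ∀ {k m t t' u} → t →F[ s! ] t' → Steps k m t' u → Steps k (suc m) t u
    std!  : ∀ {k m t t' u} → t →F[ d! ] t' → Steps k m t' u → Steps k m t u

module CBN where

  data Tm (n : ℕ) : Set where
    var : Fin n → Tm n
    lam : Tm (suc n) → Tm n
    app : Tm n → Tm n → Tm n
    es  : Tm (suc n) → Tm n → Tm n

  ren : ∀ {n m} → Ren n m → Tm n → Tm m
  ren ρ (var i)   = var (ρ i)
  ren ρ (lam t)   = lam (ren (extR ρ) t)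
  ren ρ (app t u) = app (ren ρ t) (ren ρ u)
  ren ρ (es t u)  = es (ren (extR ρ) t) (ren ρ u)

  Sub : ℕ → ℕ → Set
  Sub n m = Fin n → Tm m

  extS : ∀ {n m} → Sub n m → Sub (suc n) (suc m)
  extS σ zero    = var zero
  extS σ (suc i) = ren suc (σ i)

  sub : ∀ {n m} → Sub n m → Tm n → Tm m
  sub σ (var i)   = σ i
  sub σ (lam t)   = lam (sub (extS σ) t)
  sub σ (app t u) = app (sub σ t) (sub σ u)
  sub σ (es t u)  = es (sub (extS σ) t) (sub σ u)

  sub0 : ∀ {n} → Tm (suc n) → Tm n → Tm n
  sub0 {n} t u = sub σ t
    where
    σ : Sub (suc n) n
    σ zero    = u
    σ (suc i) = var i

  data LCtx (n : ℕ) : ℕ → Set where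
    hole : LCtx n n
    lsub : ∀ {m} → LCtx (suc n) m → Tm n → LCtx n m

  plug : ∀ {n m} → LCtx n m → Tm m → Tm n
  plug hole       t = t
  plug (lsub L s) t = es (plug L t) s

  wkL : ∀ {n m} → LCtx n m → Ren n m
  wkL hole       i = i
  wkL (lsub L s) i = wkL L (suc i)

  data Rule : Set where
    dB s : Rule

  data _↦[_]_ {n : ℕ} : Tm n → Rule → Tm n → Set where
    ↦dB : ∀ {m} (L : LCtx n m) (t : Tm (suc m)) (u : Tm n) →
          app (plug L (lam t)) u ↦[ dB ] plug L (es t (ren (wkL L) u))
    ↦s  : (t : Tm (suc n)) (u : Tm n) → es t u ↦[ s ] sub0 t u

  data _→F[_]_ : ∀ {n} → Tm n → Rule → Tm n → Set where
    root : ∀ {n R} {t u : Tm n} → t ↦[ R ] u → t →F[ R ] u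
    appL : ∀ {n R} {t t' : Tm n} (u : Tm n) → t →F[ R ] t' → app t u →F[ R ] app t' u
    appR : ∀ {n R} (t : Tm n) {u u' : Tm n} → u →F[ R ] u' → app t u →F[ R ] app t u'
    lamC : ∀ {n R} {t t' : Tm (suc n)} → t →F[ R ] t' → lam t →F[ R ] lam t'
    esL  : ∀ {n R} {t t' : Tm (suc n)} (u : Tm n) → t →F[ R ] t' → es t u →F[ R ] es t' u
    esR  : ∀ {n R} (t : Tm (suc n)) {u u' : Tm n} → u →F[ R ] u' → es t u →F[ R ] es t u'

  _→F_ : ∀ {n} → Tm n → Tm n → Set
  t →F u = Σ Rule λ R → t →F[ R ] u

  _→F*_ : ∀ {n} → Tm n → Tm n → Set
  _→F*_ = Star _→F_

  Normal : ∀ {n} → Tm n → Set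
  Normal t = ¬ (Σ _ λ u → t →F u)

  data Steps {n : ℕ} : ℕ → ℕ → Tm n → Tm n → Set where
    done : ∀ {t} → Steps 0 0 t t
    stdB : ∀ {k m t t' u} → t →F[ dB ] t' → Steps k m t' u → Steps (suc k) m t u
    sts  : ∀ {k m t t' u} → t →F[ s ] t' → Steps k m t' u → Steps k (suc m) t u

_ⁿ : ∀ {n} → CBN.Tm n → Bang.Tm n
CBN.var x ⁿ   = Bang.var x
CBN.lam t ⁿ   = Bang.lam (t ⁿ)
CBN.app t u ⁿ = Bang.app (t ⁿ) (Bang.bang (u ⁿ))
CBN.es t u ⁿ  = Bang.es (t ⁿ) (Bang.bang (u ⁿ))

-- The embedding is a strict simulation sending dB to dB and s to s! (with the
-- empty list context). Conversely, in an embedded term every ! is the argument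
-- of an application or of an explicit substitution and never sits under a list
-- context, so no d! redex occurs, s! only fires with the empty list context, and
-- every Bang step out of an embedded term is the image of a CBN step whose
-- target is again embedded. Normal forms and step counts then transfer at once.
module Submission where

open import Defs
open import Data.Nat using (ℕ; suc)
open import Data.Fin using (zero; suc)
open import Data.Product using (Σ; _×_; _,_)
open import Function.Base using (id)
open import Function.Bundles using (_⇔_; mk⇔)
open import Relation.Binary.PropositionalEquality
  using (_≡_; _≗_; refl; sym; trans; cong; cong₂; subst₂)
open import Relation.Binary.Construct.Closure.ReflexiveTransitive using (ε; _◅_; gmap)

module B = Bang
module C = CBN

extR-cong : ∀ {n m} {ρ ρ' : Ren n m} → ρ ≗ ρ' → extR ρ ≗ extR ρ'
extR-cong h zero    = refl
extR-cong h (suc i) = cong suc (h i)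

ren-cong : ∀ {n m} {ρ ρ' : Ren n m} → ρ ≗ ρ' → B.ren ρ ≗ B.ren ρ'
ren-cong h (B.var i)   = cong B.var (h i)
ren-cong h (B.app t u) = cong₂ B.app (ren-cong h t) (ren-cong h u)
ren-cong h (B.lam t)   = cong B.lam (ren-cong (extR-cong h) t)
ren-cong h (B.bang t)  = cong B.bang (ren-cong h t)
ren-cong h (B.der t)   = cong B.der (ren-cong h t)
ren-cong h (B.es t u)  = cong₂ B.es (ren-cong (extR-cong h) t) (ren-cong h u)

extR-id : ∀ {n} {ρ : Ren n n} → ρ ≗ id → extR ρ ≗ id
extR-id h zero    = refl
extR-id h (suc i) = cong suc (h i)

ren-id : ∀ {n} {ρ : Ren n n} → ρ ≗ id → B.ren ρ ≗ id
ren-id h (B.var i)   = cong B.var (h i)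
ren-id h (B.app t u) = cong₂ B.app (ren-id h t) (ren-id h u)
ren-id h (B.lam t)   = cong B.lam (ren-id (extR-id h) t)
ren-id h (B.bang t)  = cong B.bang (ren-id h t)
ren-id h (B.der t)   = cong B.der (ren-id h t)
ren-id h (B.es t u)  = cong₂ B.es (ren-id (extR-id h) t) (ren-id h u)

renⁿ : ∀ {n m} (ρ : Ren n m) (t : C.Tm n) → C.ren ρ t ⁿ ≡ B.ren ρ (t ⁿ)
renⁿ ρ (C.var i)   = refl
renⁿ ρ (C.lam t)   = cong B.lam (renⁿ (extR ρ) t)
renⁿ ρ (C.app t u) = cong₂ (λ a b → B.app a (B.bang b)) (renⁿ ρ t) (renⁿ ρ u)
renⁿ ρ (C.es t u)  = cong₂ (λ a b → B.es a (B.bang b)) (renⁿ (extR ρ) t) (renⁿ ρ u)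

extSⁿ : ∀ {n m} {σ : C.Sub n m} {τ : B.Sub n m} →
        (∀ i → σ i ⁿ ≡ τ i) → ∀ i → C.extS σ i ⁿ ≡ B.extS τ i
extSⁿ h zero            = refl
extSⁿ {σ = σ} h (suc i) = trans (renⁿ suc (σ i)) (cong (B.ren suc) (h i))

subⁿ : ∀ {n m} {σ : C.Sub n m} {τ : B.Sub n m} →
       (∀ i → σ i ⁿ ≡ τ i) → ∀ t → C.sub σ t ⁿ ≡ B.sub τ (t ⁿ)
subⁿ h (C.var i)   = h i
subⁿ h (C.lam t)   = cong B.lam (subⁿ (extSⁿ h) t)
subⁿ h (C.app t u) = cong₂ (λ a b → B.app a (B.bang b)) (subⁿ h t) (subⁿ h u)
subⁿ h (C.es t u)  = cong₂ (λ a b → B.es a (B.bang b)) (subⁿ (extSⁿ h) t) (subⁿ h u)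

_ⁿL : ∀ {n m} → C.LCtx n m → B.LCtx n m
C.hole ⁿL     = B.hole
C.lsub L s ⁿL = B.lsub (L ⁿL) (B.bang (s ⁿ))

plugⁿ : ∀ {n m} (L : C.LCtx n m) (t : C.Tm m) → C.plug L t ⁿ ≡ B.plug (L ⁿL) (t ⁿ)
plugⁿ C.hole       t = refl
plugⁿ (C.lsub L s) t = cong (λ a → B.es a (B.bang (s ⁿ))) (plugⁿ L t)

wkLⁿ : ∀ {n m} (L : C.LCtx n m) → B.wkL (L ⁿL) ≗ C.wkL L
wkLⁿ C.hole       i = refl
wkLⁿ (C.lsub L s) i = wkLⁿ L (suc i)

dB-reductⁿ : ∀ {n m} (L : C.LCtx n m) (t : C.Tm (suc m)) (u : C.Tm n) →
  C.plug L (C.es t (C.ren (C.wkL L) u)) ⁿ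
    ≡ B.plug (L ⁿL) (B.es (t ⁿ) (B.ren (B.wkL (L ⁿL)) (B.bang (u ⁿ))))
dB-reductⁿ L t u = trans (plugⁿ L _)
  (cong (λ a → B.plug (L ⁿL) (B.es (t ⁿ) (B.bang a)))
    (trans (renⁿ (C.wkL L) u) (sym (ren-cong (wkLⁿ L) (u ⁿ)))))

s-reductⁿ : ∀ {n} (t : C.Tm (suc n)) (u : C.Tm n) →
  C.sub0 t u ⁿ ≡ B.sub0 (B.ren (extR (B.wkL (B.hole {n}))) (t ⁿ)) (u ⁿ)
s-reductⁿ t u =
  trans (subⁿ (λ { zero → refl ; (suc i) → refl }) t)
        (cong (λ a → B.sub0 a (u ⁿ)) (sym (ren-id (extR-id (λ _ → refl)) (t ⁿ))))

ruleⁿ : C.Rule → B.Rule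
ruleⁿ C.dB = B.dB
ruleⁿ C.s  = B.s!

simulate-root : ∀ {n R} {t u : C.Tm n} → t C.↦[ R ] u → (t ⁿ) B.↦[ ruleⁿ R ] (u ⁿ)
simulate-root (C.↦dB L t u) =
  subst₂ B._↦[ B.dB ]_ (sym (cong (λ a → B.app a (B.bang (u ⁿ))) (plugⁿ L (C.lam t))))
    (sym (dB-reductⁿ L t u)) (B.↦dB (L ⁿL) (t ⁿ) (B.bang (u ⁿ)))
simulate-root (C.↦s t u) =
  subst₂ B._↦[ B.s! ]_ refl (sym (s-reductⁿ t u)) (B.↦s! (t ⁿ) B.hole (u ⁿ))

simulate-step : ∀ {n R} {t u : C.Tm n} → t C.→F[ R ] u → (t ⁿ) B.→F[ ruleⁿ R ] (u ⁿ)
simulate-step (C.root ρ)   = B.root (simulate-root ρ)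
simulate-step (C.appL u d) = B.appL _ (simulate-step d)
simulate-step (C.appR t d) = B.appR _ (B.bangC (simulate-step d))
simulate-step (C.lamC d)   = B.lamC (simulate-step d)
simulate-step (C.esL u d)  = B.esL _ (simulate-step d)
simulate-step (C.esR t d)  = B.esR _ (B.bangC (simulate-step d))

simulate-steps : ∀ {n} {t u : C.Tm n} → t C.→F* u → (t ⁿ) B.→F* (u ⁿ)
simulate-steps = gmap _ⁿ (λ { (R , d) → ruleⁿ R , simulate-step d })

simulate-Steps : ∀ {n k m} {t u : C.Tm n} → C.Steps k m t u → B.Steps k m (t ⁿ) (u ⁿ)
simulate-Steps C.done       = B.done
simulate-Steps (C.stdB d r) = B.stdB (simulate-step d) (simulate-Steps r)
simulate-Steps (C.sts d r)  = B.sts! (simulate-step d) (simulate-Steps r)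

-- The graph of _ⁿ as an inductive family, so that Bang steps out of an
-- embedded term can be analysed by pattern matching.
data Image {n : ℕ} : C.Tm n → B.Tm n → Set where
  var : ∀ i → Image (C.var i) (B.var i)
  lam : ∀ {t s} → Image t s → Image (C.lam t) (B.lam s)
  app : ∀ {t t' s s'} → Image t s → Image t' s' → Image (C.app t t') (B.app s (B.bang s'))
  es  : ∀ {t t' s s'} → Image t s → Image t' s' → Image (C.es t t') (B.es s (B.bang s'))

image : ∀ {n} (t : C.Tm n) → Image t (t ⁿ)
image (C.var i)   = var i
image (C.lam t)   = lam (image t)
image (C.app t u) = app (image t) (image u)
image (C.es t u)  = es (image t) (image u)

image⇒≡ : ∀ {n} {t : C.Tm n} {s} → Image t s → t ⁿ ≡ s
image⇒≡ (var i)   = refl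
image⇒≡ (lam i)   = cong B.lam (image⇒≡ i)
image⇒≡ (app i j) = cong₂ (λ a b → B.app a (B.bang b)) (image⇒≡ i) (image⇒≡ j)
image⇒≡ (es i j)  = cong₂ (λ a b → B.es a (B.bang b)) (image⇒≡ i) (image⇒≡ j)

≡⇒image : ∀ {n} {t : C.Tm n} {s} → t ⁿ ≡ s → Image t s
≡⇒image {t = t} refl = image t

image-injective : ∀ {n} {t u : C.Tm n} {s} → Image t s → Image u s → t ≡ u
image-injective (var i)   (var .i)  = refl
image-injective (lam i)   (lam j)   = cong C.lam (image-injective i j)
image-injective (app i k) (app j l) = cong₂ C.app (image-injective i j) (image-injective k l)
image-injective (es i k)  (es j l)  = cong₂ C.es (image-injective i j) (image-injective k l)

image-plug-lam : ∀ {n m} (L : B.LCtx n m) {b : B.Tm (suc m)} {t : C.Tm n} →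
  Image t (B.plug L (B.lam b)) →
  Σ (C.LCtx n m) λ L' → Σ (C.Tm (suc m)) λ b' →
    (t ≡ C.plug L' (C.lam b')) × (L ≡ L' ⁿL) × (b ≡ b' ⁿ)
image-plug-lam B.hole (lam {t = b'} i) = C.hole , b' , refl , refl , sym (image⇒≡ i)
image-plug-lam (B.lsub L _) (es {t' = u} i j) with image-plug-lam L i | image⇒≡ j
... | L' , b' , refl , refl , refl | refl = C.lsub L' u , b' , refl , refl , refl

record Reflected {n} (R : B.Rule) (t : C.Tm n) (s' : B.Tm n) : Set where
  constructor reflected
  field
    {rule}       : C.Rule
    {reduct}     : C.Tm n
    rule≡        : ruleⁿ rule ≡ R
    step         : t C.→F[ rule ] reduct
    reduct-image : Image reduct s'

reflect-under : ∀ {n n₀ R} {t : C.Tm n} {t₀ : C.Tm n₀} {s' s₀} {f : C.Tm n → C.Tm n₀} →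
  (∀ {R u} → t C.→F[ R ] u → t₀ C.→F[ R ] f u) →
  (∀ {u} → Image u s' → Image (f u) s₀) →
  Reflected R t s' → Reflected R t₀ s₀
reflect-under lift-step lift-image (reflected e d k) = reflected e (lift-step d) (lift-image k)

reflect-step : ∀ {n R} {t : C.Tm n} {s s'} → s B.→F[ R ] s' → Image t s → Reflected R t s'
reflect-step (B.root (B.↦dB L b _)) (app {t' = u} i j) with image-plug-lam L i | image⇒≡ j
... | L' , b' , refl , refl , refl | refl =
  reflected refl (C.root (C.↦dB L' b' u)) (≡⇒image (dB-reductⁿ L' b' u))
reflect-step (B.root (B.↦s! _ B.hole _)) (es {t = t} {t' = u} i j) with image⇒≡ i | image⇒≡ j
... | refl | refl = reflected refl (C.root (C.↦s t u)) (≡⇒image (s-reductⁿ t u))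
reflect-step (B.root (B.↦s! _ (B.lsub _ _) _)) ()
reflect-step (B.root (B.↦d! _ _)) ()
reflect-step (B.appL _ d) (app i j) =
  reflect-under (C.appL _) (λ k → app k j) (reflect-step d i)
reflect-step (B.appR _ (B.root ())) (app i j)
reflect-step (B.appR _ (B.bangC d)) (app i j) =
  reflect-under (C.appR _) (app i) (reflect-step d j)
reflect-step (B.lamC d) (lam i) = reflect-under C.lamC lam (reflect-step d i)
reflect-step (B.esL _ d) (es i j) =
  reflect-under (C.esL _) (λ k → es k j) (reflect-step d i)
reflect-step (B.esR _ (B.root ())) (es i j)
reflect-step (B.esR _ (B.bangC d)) (es i j) =
  reflect-under (C.esR _) (es i) (reflect-step d j)

image-closed : ∀ {n} {t : C.Tm n} {s s'} → Image t s → s B.→F* s' → Σ (C.Tm n) λ u → Image u s'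
image-closed {t = t} i ε       = t , i
image-closed i ((_ , d) ◅ r) = image-closed (Reflected.reduct-image (reflect-step d i)) r

reflect-steps : ∀ {n} {t u : C.Tm n} {s s'} → Image t s → s B.→F* s' → Image u s' → t C.→F* u
reflect-steps i ε j with image-injective i j
... | refl = ε
reflect-steps i ((_ , d) ◅ r) j with reflect-step d i
... | reflected _ d' k = (_ , d') ◅ reflect-steps k r j

reflect-Steps : ∀ {n k m} {t u : C.Tm n} {s s'} → Image t s → B.Steps k m s s' → Image u s' →
  C.Steps k m t u
reflect-Steps i B.done j with image-injective i j
... | refl = C.done
reflect-Steps i (B.stdB d r) j with reflect-step d i
... | reflected {C.dB} refl d' k = C.stdB d' (reflect-Steps k r j)
reflect-Steps i (B.sts! d r) j with reflect-step d i
... | reflected {C.s} refl d' k = C.sts d' (reflect-Steps k r j)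
reflect-Steps i (B.std! d r) j with reflect-step d i
... | reflected {C.dB} () _ _
... | reflected {C.s} () _ _

stability : ∀ {n} (t : C.Tm n) {s'} → (t ⁿ) B.→F* s' → Σ (C.Tm n) λ u → u ⁿ ≡ s'
stability t r with image-closed (image t) r
... | u , k = u , image⇒≡ k

normal⇔normalⁿ : ∀ {n} (t : C.Tm n) → C.Normal t ⇔ B.Normal (t ⁿ)
normal⇔normalⁿ t = mk⇔
  (λ { nf (_ , _ , d) → nf (_ , _ , Reflected.step (reflect-step d (image t))) })
  (λ { nf (_ , R , d) → nf (_ , ruleⁿ R , simulate-step d) })

corollary1 : ∀ {n} →
    ((t : CBN.Tm n) (s' : Bang.Tm n) → Bang._→F*_ (t ⁿ) s' →
       Σ (CBN.Tm n) λ s → s ⁿ ≡ s')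
    ×
    ((t : CBN.Tm n) → CBN.Normal t ⇔ Bang.Normal (t ⁿ))
    ×
    ((t u : CBN.Tm n) → CBN._→F*_ t u ⇔ Bang._→F*_ (t ⁿ) (u ⁿ))
    ×
    ((t u : CBN.Tm n) (k m : ℕ) →
       CBN.Steps k m t u ⇔ Bang.Steps k m (t ⁿ) (u ⁿ))
corollary1 =
  (λ t _ → stability t) ,
  normal⇔normalⁿ ,
  (λ t u → mk⇔ simulate-steps (λ r → reflect-steps (image t) r (image u))) ,
  (λ t u _ _ → mk⇔ simulate-Steps (λ r → reflect-Steps (image t) r (image u)))
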